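{- For any positive integers $d,\eta,N,d'$ there exists an integer $N^*$ such that the following holds. Let $k$ be a positive integer and let $G$ be a graph with maximum degree at most $d$ that is $k$-colorable with clustering $N$. Let $G'$ be a graph with maximum degree at most $d'$ obtained from $G$ by identifying a set of at most $\eta$ vertices into a single vertex, then adding a set $I$ of new vertices and adding edges incident with $I$, such that $I$ is a stable set in $G'$ and the neighborhood of each vertex of $I$ is a clique of size at most $\eta$. Then $G'$ is $k$-colorable with clustering $N^*$.
   Context: Graphs are finite and may have loops and parallel edges; degree counts loops twice. For positive integers $k,N$, $G$ is $k$-colorable with clustering $N$ if there is $c:V(G)\to\{1,\dots,k\}$ such that every connected component of each induced subgraph $G[c^{ -1}(i)]$ has at most $N$ vertices. -}

module Defs where

open import Data.Nat using (ℕ; zero; suc; _+_; _≤_)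
open import Data.Fin using (Fin; _↑ˡ_; _↑ʳ_)
open import Data.Fin.Properties using (_≟_)
open import Data.List using (List; map; length; _++_)
open import Data.Nat.ListAction using (sum)
open import Data.List.Membership.Propositional using (_∈_)
open import Data.List.Relation.Unary.All using (All)
open import Data.List.Relation.Unary.Unique.Propositional using (Unique)
open import Data.Product using (_×_; _,_; ∃)
open import Data.Sum using (_⊎_)
open import Relation.Binary.PropositionalEquality using (_≡_; _≢_)
open import Relation.Nullary using (yes; no)

-- A finite multigraph on vertex set Fin n: a list of edges, each edge given
-- by its two ends (a loop is an edge (v , v); repeated entries = parallel edges).
Graph : ℕ → Set
Graph n = List (Fin n × Fin n)

-- number of ends of an edge equal to v (a loop at v contributes 2)
ends : ∀ {n} → Fin n → Fin n × Fin n → ℕ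
ends v (a , b) = (if≡ a) + (if≡ b)
  where
  if≡ : _ → ℕ
  if≡ x with x ≟ v
  ... | yes _ = 1
  ... | no  _ = 0

deg : ∀ {n} → Graph n → Fin n → ℕ
deg E v = sum (map (ends v) E)

MaxDeg≤ : ∀ {n} → Graph n → ℕ → Set
MaxDeg≤ E d = ∀ v → deg E v ≤ d

Adj : ∀ {n} → Graph n → Fin n → Fin n → Set
Adj E u v = ((u , v) ∈ E) ⊎ ((v , u) ∈ E)

data MonoReach {n k} (E : Graph n) (c : Fin n → Fin k) (u : Fin n) : Fin n → Set where
  here : MonoReach E c u u
  step : ∀ {w v} → MonoReach E c u w → Adj E w v → c v ≡ c u → MonoReach E c u v

Clustered : ∀ {n k} → Graph n → (Fin n → Fin k) → ℕ → Set
Clustered {n} E c N =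
  ∀ (u : Fin n) (vs : List (Fin n)) → Unique vs → All (MonoReach E c u) vs → length vs ≤ N

ColorableClust : ∀ {n} → ℕ → ℕ → Graph n → Set
ColorableClust {n} k N E = ∃ λ (c : Fin n → Fin k) → Clustered E c N

-- φ : V(G) → Fin m is the quotient map identifying the set S (|S| ≤ η) into
-- a single vertex: surjective, constant on S, injective outside S.
IsIdentification : ∀ {n m} → (Fin n → Fin m) → List (Fin n) → ℕ → Set
IsIdentification {n} {m} φ S η =
  Unique S × length S ≤ η
  × (∀ (y : Fin m) → ∃ λ (u : Fin n) → φ u ≡ y)
  × (∀ u v → u ∈ S → v ∈ S → φ u ≡ φ v)
  × (∀ u v → φ u ≡ φ v → (u ≡ v) ⊎ ((u ∈ S) × (v ∈ S)))

-- G' on vertex set Fin (m + i): old vertices x ↑ˡ i (image of the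
-- identification, all edges of G carried along), new vertices I = m ↑ʳ j,
-- and new edges F, each joining an old vertex to a vertex of I
-- (so I is stable in G').
Extend : ∀ {n m i} → (Fin n → Fin m) → Graph n → List (Fin m × Fin i) → Graph (m + i)
Extend {m = m} {i = i} φ E F =
  map (λ { (a , b) → (φ a ↑ˡ i , φ b ↑ˡ i) }) E
  ++ map (λ { (x , j) → (x ↑ˡ i , m ↑ʳ j) }) F

NbhdCliqueAtMost : ∀ {n} → Graph n → Fin n → ℕ → Set
NbhdCliqueAtMost {n} E w η =
  (∀ u v → Adj E w u → Adj E w v → u ≢ v → Adj E u v)
  × (∀ (vs : List (Fin n)) → Unique vs → All (Adj E w) vs → length vs ≤ η)

module Submission where

-- Let c be a k-colouring of G with clustering N.  Colour
-- G' by giving every old vertex y the colour of an arbitrary preimage ψ y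
-- (for the identified vertex z this preimage lies in S), and every new
-- vertex (in I) colour 0.  We show that every monochromatic component of G'
-- has bounded radius; as G' has maximum degree ≤ d', it then has at most
-- (d'+1)^radius vertices.
--
-- A monochromatic walk in G' may be assumed to avoid I: the
-- neighbourhood of a vertex of I is a clique, so a detour w – j – v through
-- j ∈ I can be replaced by the edge w v.  Away from z, a monochromatic walk
-- of G' lifts to a monochromatic walk of G, which stays within distance N
-- of its start (clustering N).  Hence, starting at an old vertex u, the
-- walk either never meets z, or meets z within distance N + 1 of u; after
-- leaving z it continues inside a monochromatic component of G starting at
-- a neighbour of S, i.e. at most N + 1 further steps.  So the old vertices
-- of the component of u lie within distance 2N + 2 of u, the new ones within
-- 2N + 3, and measured from a new vertex everything is within 2N + 4.

open import Defs
open import Data.Nat using (ℕ; zero; suc; _+_; _*_; _^_; _≤_; z≤n; s≤s)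
open import Data.Nat.Properties using (≤-trans; n≤1+n; m≤n+m; +-mono-≤; +-monoʳ-≤; *-monoʳ-≤; *-suc; module ≤-Reasoning)
open import Data.Fin using (Fin; zero; _↑ˡ_; _↑ʳ_; splitAt)
open import Data.Fin.Properties using (_≟_; splitAt-↑ˡ; splitAt-↑ʳ; ↑ˡ-injective; splitAt⁻¹-↑ˡ; splitAt⁻¹-↑ʳ)
open import Data.List using (List; []; _∷_; map; length; _++_; concatMap)
open import Data.List.Properties using (length-++)
open import Data.List.Membership.Propositional using (_∈_; _∉_; lose)
open import Data.List.Membership.Propositional.Properties using (∈-++⁺ˡ; ∈-++⁺ʳ; ∈-++⁻; ∈-map⁺; ∈-map⁻; ∈-concatMap⁺)
open import Data.List.Relation.Unary.Any using (here; there)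
open import Data.List.Relation.Unary.All as All using (All; []; _∷_)
open import Data.List.Relation.Unary.All.Properties using (¬Any⇒All¬)
open import Data.List.Relation.Unary.AllPairs using ([]; _∷_)
open import Data.List.Relation.Unary.Unique.Propositional using (Unique)
open import Data.Product using (_×_; _,_; ∃; proj₁; proj₂)
open import Data.Sum using (_⊎_; inj₁; inj₂; [_,_])
open import Data.Empty using (⊥-elim)
open import Relation.Binary.PropositionalEquality
  using (_≡_; _≢_; refl; sym; trans; cong; cong₂; subst)
open import Relation.Nullary using (yes; no; ¬_)

remove : ∀ {A : Set} {x : A} (L : List A) → x ∈ L → List A
remove (_ ∷ L) (here _)  = L
remove (y ∷ L) (there p) = y ∷ remove L p

length-remove : ∀ {A : Set} {x : A} (L : List A) (p : x ∈ L) →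
                suc (length (remove L p)) ≡ length L
length-remove (_ ∷ L) (here _)  = refl
length-remove (y ∷ L) (there p) = cong suc (length-remove L p)

∈-remove : ∀ {A : Set} {x y : A} (L : List A) (p : x ∈ L) → y ∈ L → x ≢ y → y ∈ remove L p
∈-remove (_ ∷ L) (here refl) (here refl) x≢y = ⊥-elim (x≢y refl)
∈-remove (_ ∷ L) (here refl) (there q)   _   = q
∈-remove (_ ∷ L) (there p)   (here refl) _   = here refl
∈-remove (_ ∷ L) (there p)   (there q)   x≢y = there (∈-remove L p q x≢y)

unique⊆⇒length≤ : ∀ {A : Set} (vs L : List A) → Unique vs → All (_∈ L) vs →
                  length vs ≤ length L
unique⊆⇒length≤ []       L _              _              = z≤n
unique⊆⇒length≤ (x ∷ vs) L (x∉vs ∷ uniq) (x∈L ∷ vs⊆L) =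
  subst (suc (length vs) ≤_) (length-remove L x∈L)
    (s≤s (unique⊆⇒length≤ vs (remove L x∈L) uniq
            (All.zipWith (λ (x≢w , w∈L) → ∈-remove L x∈L w∈L x≢w) (x∉vs , vs⊆L))))

adj-sym : ∀ {n} {E : Graph n} {u v} → Adj E u v → Adj E v u
adj-sym (inj₁ p) = inj₂ p
adj-sym (inj₂ p) = inj₁ p

-- Walk E u r v: there is a walk from u to v in E of length at most r.
data Walk {n} (E : Graph n) (u : Fin n) : ℕ → Fin n → Set where
  wz : ∀ {r} → Walk E u r u
  ws : ∀ {r w v} → Walk E u r w → Adj E w v → Walk E u (suc r) v

walk-weaken : ∀ {n} {E : Graph n} {u v r r'} → Walk E u r v → r ≤ r' → Walk E u r' v
walk-weaken wz       _         = wz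
walk-weaken (ws p a) (s≤s r≤r') = ws (walk-weaken p r≤r') a

walk-++ : ∀ {n} {E : Graph n} {u w v r s} → Walk E u r w → Walk E w s v → Walk E u (s + r) v
walk-++ {s = s} p wz = walk-weaken p (m≤n+m _ s)
walk-++ p (ws q a)   = ws (walk-++ p q) a

walk-cons : ∀ {n} {E : Graph n} {u w v r} → Adj E u w → Walk E w r v → Walk E u (suc r) v
walk-cons a wz        = ws wz a
walk-cons a (ws p a') = ws (walk-cons a p) a'

edge-neighbours : ∀ {n} → Fin n → Fin n × Fin n → List (Fin n)
edge-neighbours x (a , b) = from a b ++ from b a
  where
  from : Fin _ → Fin _ → List (Fin _)
  from end other with end ≟ x
  ... | yes _ = other ∷ []
  ... | no  _ = []

neighbours : ∀ {n} → Graph n → Fin n → List (Fin n)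
neighbours E x = concatMap (edge-neighbours x) E

length-edge-neighbours : ∀ {n} (x : Fin n) e → length (edge-neighbours x e) ≡ ends x e
length-edge-neighbours x (a , b) with a ≟ x | b ≟ x
... | yes _ | yes _ = refl
... | yes _ | no  _ = refl
... | no  _ | yes _ = refl
... | no  _ | no  _ = refl

length-neighbours : ∀ {n} (E : Graph n) x → length (neighbours E x) ≡ deg E x
length-neighbours []      x = refl
length-neighbours (e ∷ E) x =
  trans (length-++ (edge-neighbours x e))
        (cong₂ _+_ (length-edge-neighbours x e) (length-neighbours E x))

adj⇒neighbour : ∀ {n} (E : Graph n) {x v} → Adj E x v → v ∈ neighbours E x
adj⇒neighbour E {x} {v} (inj₁ xv∈E) = ∈-concatMap⁺ (edge-neighbours x) (lose xv∈E first)
  where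
  first : v ∈ edge-neighbours x (x , v)
  first with x ≟ x
  ... | yes _ = here refl
  ... | no  x≢x = ⊥-elim (x≢x refl)
adj⇒neighbour E {x} {v} (inj₂ vx∈E) = ∈-concatMap⁺ (edge-neighbours x) (lose vx∈E second)
  where
  second : v ∈ edge-neighbours x (v , x)
  second with v ≟ x | x ≟ x
  ... | _     | no  x≢x = ⊥-elim (x≢x refl)
  ... | yes _ | yes _   = there (here refl)
  ... | no  _ | yes _   = here refl

length-concatMap≤ : ∀ {A B : Set} (f : A → List B) (D : ℕ) xs →
                    (∀ x → length (f x) ≤ D) → length (concatMap f xs) ≤ D * length xs
length-concatMap≤ f D []       _ = z≤n
length-concatMap≤ f D (x ∷ xs) h = begin
  length (f x ++ concatMap f xs)          ≡⟨ length-++ (f x) ⟩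
  length (f x) + length (concatMap f xs) ≤⟨ +-mono-≤ (h x) (length-concatMap≤ f D xs h) ⟩
  D + D * length xs                       ≡⟨ sym (*-suc D (length xs)) ⟩
  D * suc (length xs)                     ∎
  where open ≤-Reasoning

ball : ∀ {n} → Graph n → Fin n → ℕ → List (Fin n)
ball E u zero    = u ∷ []
ball E u (suc r) = ball E u r ++ concatMap (neighbours E) (ball E u r)

ball-size : ∀ {n} (E : Graph n) {D} → MaxDeg≤ E D → ∀ u r → length (ball E u r) ≤ suc D ^ r
ball-size E {D} maxdeg u zero    = s≤s z≤n
ball-size E {D} maxdeg u (suc r) = begin
  length (B ++ concatMap (neighbours E) B)          ≡⟨ length-++ B ⟩
  length B + length (concatMap (neighbours E) B)   ≤⟨ +-monoʳ-≤ (length B) (length-concatMap≤ (neighbours E) D B neighbours≤D) ⟩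
  length B + D * length B                           ≤⟨ *-monoʳ-≤ (suc D) (ball-size E maxdeg u r) ⟩
  suc D * suc D ^ r                                 ∎
  where
  open ≤-Reasoning
  B : List _
  B = ball E u r
  neighbours≤D : ∀ x → length (neighbours E x) ≤ D
  neighbours≤D x = subst (_≤ D) (sym (length-neighbours E x)) (maxdeg x)

centre∈ball : ∀ {n} (E : Graph n) u r → u ∈ ball E u r
centre∈ball E u zero    = here refl
centre∈ball E u (suc r) = ∈-++⁺ˡ (centre∈ball E u r)

walk⇒∈ball : ∀ {n} (E : Graph n) {u v r} → Walk E u r v → v ∈ ball E u r
walk⇒∈ball E {u} {r = r} wz = centre∈ball E u r
walk⇒∈ball E {u} (ws {r} p a) =
  ∈-++⁺ʳ (ball E u r) (∈-concatMap⁺ (neighbours E) (lose (walk⇒∈ball E p) (adj⇒neighbour E a)))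

bounded-radius⇒clustered : ∀ {n k} {E : Graph n} {c : Fin n → Fin k} {D R} →
  MaxDeg≤ E D → (∀ u {v} → MonoReach E c u v → Walk E u R v) → Clustered E c (suc D ^ R)
bounded-radius⇒clustered {E = E} {R = R} maxdeg radius u vs uniq reach =
  ≤-trans (unique⊆⇒length≤ vs (ball E u R) uniq (All.map (λ p → walk⇒∈ball E (radius u p)) reach))
          (ball-size E maxdeg u R)

mono-first-step : ∀ {n k} {E : Graph n} {c : Fin n → Fin k} {u v} → MonoReach E c u v →
  u ≡ v ⊎ ∃ λ w → Adj E u w × c w ≡ c u × MonoReach E c w v
mono-first-step here = inj₁ refl
mono-first-step (step p a e) with mono-first-step p
... | inj₁ refl = inj₂ (_ , a , e , here)
... | inj₂ (w , uw , cw , q) = inj₂ (w , uw , cw , step q a (trans e (sym cw)))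

clustered⇒walk : ∀ {n k} {E : Graph n} {c : Fin n → Fin k} {N u v} →
  Clustered E c N → MonoReach E c u v → Walk E u N v
clustered⇒walk {n} {E = E} {c} {u = u} cl p with witness p
  where
  open import Data.List.Membership.DecPropositional (_≟_ {n}) using (_∈?_)

  -- v is reached inside a duplicate-free list of vertices of the component
  -- of u, each joined to u by a walk no longer than the list.
  Witness : Fin n → Set
  Witness v = ∃ λ ps → Unique ps × All (MonoReach E c u) ps × v ∈ ps
                      × All (Walk E u (length ps)) ps

  witness : ∀ {v} → MonoReach E c u v → Witness v
  witness here = (u ∷ []) , ([] ∷ []) , (here ∷ []) , here refl , (wz ∷ [])
  witness {v} (step {w} p a e) with witness p
  ... | ps , uniq , reach , w∈ps , walks with v ∈? ps
  ...   | yes v∈ps = ps , uniq , reach , v∈ps , walks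
  ...   | no  v∉ps =
    (v ∷ ps) , (¬Any⇒All¬ ps v∉ps ∷ uniq) , (step p a e ∷ reach) , here refl ,
    (ws (All.lookup walks w∈ps) a ∷ All.map (λ q → walk-weaken q (n≤1+n _)) walks)
... | ps , uniq , reach , v∈ps , walks = walk-weaken (All.lookup walks v∈ps) (cl u ps uniq reach)

module Extension {n m i} (φ : Fin n → Fin m) (E : Graph n) (F : List (Fin m × Fin i)) where

  E' : Graph (m + i)
  E' = Extend φ E F

  old : Fin m → Fin (m + i)
  old y = y ↑ˡ i

  new : Fin i → Fin (m + i)
  new j = m ↑ʳ j

  old≢new : ∀ y j → old y ≢ new j
  old≢new y j eq with trans (sym (splitAt-↑ˡ m y i)) (trans (cong (splitAt m) eq) (splitAt-↑ʳ m i j))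
  ... | ()

  old-or-new : ∀ v → (∃ λ y → v ≡ old y) ⊎ (∃ λ j → v ≡ new j)
  old-or-new v with splitAt m v in eq
  ... | inj₁ y = inj₁ (y , sym (splitAt⁻¹-↑ˡ eq))
  ... | inj₂ j = inj₂ (j , sym (splitAt⁻¹-↑ʳ eq))

  adj-lift : ∀ {a b} → Adj E a b → Adj E' (old (φ a)) (old (φ b))
  adj-lift (inj₁ p) = inj₁ (∈-++⁺ˡ (∈-map⁺ _ p))
  adj-lift (inj₂ p) = inj₂ (∈-++⁺ˡ (∈-map⁺ _ p))

  walk-lift : ∀ {t r y} → Walk E t r y → Walk E' (old (φ t)) r (old (φ y))
  walk-lift wz       = wz
  walk-lift (ws p a) = ws (walk-lift p) (adj-lift a)

  edge-old⁻ : ∀ {x y} → (old x , old y) ∈ E' → ∃ λ a → ∃ λ b → (a , b) ∈ E × φ a ≡ x × φ b ≡ y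
  edge-old⁻ {x} {y} p with ∈-++⁻ (map _ E) p
  ... | inj₁ q with ∈-map⁻ _ q
  ...   | (a , b) , ab∈E , eq =
    a , b , ab∈E , sym (↑ˡ-injective i _ _ (cong proj₁ eq)) , sym (↑ˡ-injective i _ _ (cong proj₂ eq))
  edge-old⁻ {x} {y} p | inj₂ q with ∈-map⁻ _ q
  ...   | (_ , j) , _ , eq = ⊥-elim (old≢new y j (cong proj₂ eq))

  adj-old⁻ : ∀ {x y} → Adj E' (old x) (old y) → ∃ λ a → ∃ λ b → Adj E a b × φ a ≡ x × φ b ≡ y
  adj-old⁻ (inj₁ p) with edge-old⁻ p
  ... | a , b , ab , ea , eb = a , b , inj₁ ab , ea , eb
  adj-old⁻ (inj₂ p) with edge-old⁻ p
  ... | b , a , ab , eb , ea = a , b , inj₂ ab , ea , eb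

  edge-new⁻ : ∀ {j j'} → (new j , new j') ∉ E'
  edge-new⁻ {j} p with ∈-++⁻ (map _ E) p
  ... | inj₁ q with ∈-map⁻ _ q
  ...   | (a , _) , _ , eq = old≢new (φ a) j (sym (cong proj₁ eq))
  edge-new⁻ {j} p | inj₂ q with ∈-map⁻ _ q
  ...   | (x , _) , _ , eq = old≢new x j (sym (cong proj₁ eq))

  new-stable : ∀ {j j'} → ¬ Adj E' (new j) (new j')
  new-stable (inj₁ p) = edge-new⁻ p
  new-stable (inj₂ p) = edge-new⁻ p

-- 2N + 4: every vertex of a monochromatic component of G' is within this
-- distance of any other vertex of it (for clustering N in G).
radius-bound : ℕ → ℕ
radius-bound N = suc (suc (N + suc (suc N)))

module Recolouring {n m i k N} (E : Graph n) (c : Fin n → Fin (suc k)) (cl : Clustered E c N)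
  (φ : Fin n → Fin m) (S : List (Fin n)) (F : List (Fin m × Fin i))
  (surj : ∀ (y : Fin m) → ∃ λ (u : Fin n) → φ u ≡ y)
  (constS : ∀ u v → u ∈ S → v ∈ S → φ u ≡ φ v)
  (inj : ∀ u v → φ u ≡ φ v → (u ≡ v) ⊎ ((u ∈ S) × (v ∈ S)))
  (clique : ∀ j u v → Adj (Extend φ E F) (m ↑ʳ j) u → Adj (Extend φ E F) (m ↑ʳ j) v →
            u ≢ v → Adj (Extend φ E F) u v)
  where

  open Extension φ E F

  -- A chosen preimage of each old vertex; for the identified vertex it lies in S.
  ψ : Fin m → Fin n
  ψ y = proj₁ (surj y)

  old-φψ : ∀ y → old y ≡ old (φ (ψ y))
  old-φψ y = cong old (sym (proj₂ (surj y)))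

  c' : Fin (m + i) → Fin (suc k)
  c' v = [ (λ y → c (ψ y)) , (λ _ → zero) ] (splitAt m v)

  c'-old : ∀ y → c' (old y) ≡ c (ψ y)
  c'-old y rewrite splitAt-↑ˡ m y i = refl

  module FromOld (x : Fin m) where

    u : Fin (m + i)
    u = old x

    t₀ : Fin n
    t₀ = ψ x

    colour : Fin (suc k)
    colour = c t₀

    -- The identified vertex is within distance N + 1 of u.
    ZClose : Set
    ZClose = ∃ λ s → s ∈ S × Walk E' u (suc N) (old (φ s))

    NearS : Fin n → Set
    NearS t = ∃ λ s → s ∈ S × (s ≡ t ⊎ Adj E s t)

    -- Starting points in G from which the component of u is explored: t₀,
    -- and, once the identified vertex is close to u, every vertex near S.
    Seed : Fin n → Set
    Seed t = t ≡ t₀ ⊎ (ZClose × NearS t)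

    Reached : Fin n → Set
    Reached t = ∃ λ t' → Seed t' × c t' ≡ colour × MonoReach E c t' t

    close-walk : ZClose → ∀ {s} → s ∈ S → Walk E' u (suc N) (old (φ s))
    close-walk (s₀ , s₀∈S , w) s∈S =
      subst (λ y → Walk E' u (suc N) (old y)) (constS s₀ _ s₀∈S s∈S) w

    seed-walk : ∀ {t} → Seed t → Walk E' u (suc (suc N)) (old (φ t))
    seed-walk (inj₁ refl)                       = subst (Walk E' u _) (old-φψ x) wz
    seed-walk (inj₂ (zc , s , s∈S , inj₁ refl)) = walk-weaken (close-walk zc s∈S) (n≤1+n _)
    seed-walk (inj₂ (zc , s , s∈S , inj₂ st))   = ws (close-walk zc s∈S) (adj-lift st)

    lifted-component-walk : ∀ {t' t} → MonoReach E c t' t → Walk E' (old (φ t')) N (old (φ t))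
    lifted-component-walk mr = walk-lift (clustered⇒walk cl mr)

    reached-walk : ∀ {t} → Reached t → Walk E' u (N + suc (suc N)) (old (φ t))
    reached-walk (_ , seed , _ , mr) = walk-++ (seed-walk seed) (lifted-component-walk mr)

    reached-near : ∀ {t} → Reached t → ZClose ⊎ Walk E' u N (old (φ t))
    reached-near (_ , inj₁ refl , _ , mr) =
      inj₂ (subst (λ v → Walk E' v N _) (sym (old-φψ x)) (lifted-component-walk mr))
    reached-near (_ , inj₂ (zc , _) , _ , _) = inj₁ zc

    close-at : ∀ {t} → Reached t → t ∈ S → ZClose
    close-at r t∈S = [ (λ zc → zc) , (λ w → _ , t∈S , walk-weaken w (n≤1+n N)) ] (reached-near r)

    close-next : ∀ {t s} → Reached t → Adj E' (old (φ t)) (old (φ s)) → s ∈ S → ZClose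
    close-next r adj s∈S = [ (λ zc → zc) , (λ w → _ , s∈S , ws w adj) ] (reached-near r)

    reached-step : ∀ {t b} → Reached t → Adj E t b → c b ≡ colour → Reached b
    reached-step (t' , seed , ct' , mr) tb cb = t' , seed , ct' , step mr tb (trans cb (sym ct'))

    OldReached : Fin (m + i) → Set
    OldReached v = ∃ λ t → v ≡ old (φ t) × Reached t

    InComponent : Fin (m + i) → Set
    InComponent v = OldReached v ⊎ (∃ λ j → v ≡ new j × ∃ λ w → Adj E' v w × OldReached w)

    -- An edge of G' − I leaving the image of a reached vertex t lifts to an
    -- edge ab of G.  If the edge reaches the identified vertex, or leaves it
    -- (t ∈ S), that vertex is close to u and the far end is a seed near S;
    -- otherwise a = t and the G-component of t is simply extended.
    old-step : ∀ {t y} → Reached t → Adj E' (old (φ t)) (old y) → c (ψ y) ≡ colour →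
               OldReached (old y)
    old-step {t} {y} r adj cy with adj-old⁻ adj
    ... | a , b , ab , φa , φb with inj a t φa | inj b (ψ y) (trans φb (sym (proj₂ (surj y))))
    ... | _ | inj₂ (_ , ψy∈S) =
      ψ y , old-φψ y ,
      (ψ y , inj₂ (close-next r (subst (Adj E' _) (old-φψ y) adj) ψy∈S , ψ y , ψy∈S , inj₁ refl) , cy , here)
    ... | inj₁ refl | inj₁ refl = ψ y , old-φψ y , reached-step r ab cy
    ... | inj₂ (a∈S , t∈S) | inj₁ refl =
      ψ y , old-φψ y , (ψ y , inj₂ (close-at r t∈S , a , a∈S , inj₂ ab) , cy , here)

    step-from-old : ∀ {w v} → OldReached w → Adj E' w v → c' v ≡ colour → InComponent v
    step-from-old {v = v} (t , refl , r) adj cv with old-or-new v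
    ... | inj₁ (y , refl) = inj₁ (old-step r adj (trans (sym (c'-old y)) cv))
    ... | inj₂ (j , refl) = inj₂ (j , refl , _ , adj-sym adj , t , refl , r)

    -- A step out of a new vertex j can be short-cut, as the neighbours of j form a clique.
    component-step : ∀ {w v} → InComponent w → Adj E' w v → c' v ≡ colour → InComponent v
    component-step (inj₁ ow) adj cv = step-from-old ow adj cv
    component-step {v = v} (inj₂ (j , refl , w₀ , jw₀ , ow₀)) jv cv with v ≟ w₀
    ... | yes refl = inj₁ ow₀
    ... | no  v≢w₀ = step-from-old ow₀ (clique j w₀ v jw₀ jv (λ e → v≢w₀ (sym e))) cv

    in-component : ∀ {v} → MonoReach E' c' u v → InComponent v
    in-component here           = inj₁ (t₀ , old-φψ x , t₀ , inj₁ refl , refl , here)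
    in-component (step p adj e) = component-step (in-component p) adj (trans e (c'-old x))

    in-component-walk : ∀ {v} → InComponent v → Walk E' u (suc (N + suc (suc N))) v
    in-component-walk (inj₁ (t , refl , r)) = walk-weaken (reached-walk r) (n≤1+n _)
    in-component-walk (inj₂ (j , refl , w , adj , t , refl , r)) = ws (reached-walk r) (adj-sym adj)

  old-radius : ∀ x {v} → MonoReach E' c' (old x) v → Walk E' (old x) (suc (N + suc (suc N))) v
  old-radius x p = FromOld.in-component-walk x (FromOld.in-component x p)

  -- A component containing a new vertex j also contains an old neighbour of j.
  radius : ∀ u {v} → MonoReach E' c' u v → Walk E' u (radius-bound N) v
  radius u p with old-or-new u
  ... | inj₁ (x , refl) = walk-weaken (old-radius x p) (n≤1+n _)
  ... | inj₂ (j , refl) with mono-first-step p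
  ...   | inj₁ refl = wz
  ...   | inj₂ (w , jw , _ , q) with old-or-new w
  ...     | inj₁ (x , refl)  = walk-cons jw (old-radius x q)
  ...     | inj₂ (_ , refl) = ⊥-elim (new-stable jw)

  clustered : ∀ {d'} → MaxDeg≤ E' d' → Clustered E' c' (suc d' ^ radius-bound N)
  clustered maxdeg = bounded-radius⇒clustered maxdeg radius

-- Colour G' by the recolouring; N* = (d'+1)^(2N+4).
lemma5p3 : (d η N d' : ℕ) → 1 ≤ d → 1 ≤ η → 1 ≤ N → 1 ≤ d' →
    ∃ λ (Nstar : ℕ) →
      ∀ (k : ℕ) → 1 ≤ k →
      ∀ (n : ℕ) (E : Graph n) → MaxDeg≤ E d → ColorableClust k N E →
      ∀ (m i : ℕ) (φ : Fin n → Fin m) (S : List (Fin n)) (F : List (Fin m × Fin i)) →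
      IsIdentification φ S η →
      MaxDeg≤ (Extend φ E F) d' →
      (∀ (j : Fin i) → NbhdCliqueAtMost (Extend φ E F) (m ↑ʳ j) η) →
      ColorableClust k Nstar (Extend φ E F)
lemma5p3 d η N d' _ _ _ _ = suc d' ^ radius-bound N , λ where
  zero    ()
  (suc k) _ n E _ (c , cl) m i φ S F (_ , _ , surj , constS , inj) maxdeg' nbhd →
    let open Recolouring E c cl φ S F surj constS inj (λ j → proj₁ (nbhd j))
    in  c' , clustered maxdeg'
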